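{- Let $L$ be a linear order with $\operatorname{coi}(L)\le\aleph_0$ and let $\mathcal{T}=(T,\le_T,\lambda_T)$ be a weak $L$-tree. Let $b$ be a branch of the condensed tree $\Delta(\mathcal{T})$, let $\bar\ell\in L$, and fix $t\in b(\bar\ell)$. Then there is a branch $b'$ of $\mathcal{T}$ such that $b'(\bar\ell)=t$ and $b'(\ell)\in b(\ell)$ for every $\ell\in L$.
   Context: $\operatorname{coi}(L)$ is the least cardinal $\kappa$ such that some $\kappa$-sequence is coinitial in $L$. A weak $L$-tree is $(T,\le_T,\lambda_T)$ with $(T,\le_T)$ a partial order and $\lambda_T\colon T\to L$ surjective such that for all $t,t'$: $t<_Tt'$ implies $\lambda_T(t)<\lambda_T(t')$; for each $\ell\ge\lambda_T(t)$ there is a unique $t|_\ell\ge_Tt$ with $\lambda_T(t|_\ell)=\ell$; and $t|_\ell=t'|_\ell$ for some $\ell\ge\max\{\lambda_T(t),\lambda_T(t')\}$. A branch of a weak $L$-tree is $b\colon L\to T$ with $\lambda_T(b(\ell))=\ell$ and $b(\ell)\le_Tb(\ell')$ for $\ell\le\ell'$. $\operatorname{Aut}(\mathcal{T})$ is the group of level-preserving order automorphisms; $t\sim t'$ iff $f(t)=t'$ for some $f\in\operatorname{Aut}(\mathcal{T})$, with class $[t]$. The condensed tree $\Delta(\mathcal{T})$ has domain $T/{\sim}$, level function $\lambda([t])=\lambda_T(t)$, and order $\delta\le\delta'$ iff $t\le_Tt'$ for some $t\in\delta$, $t'\in\delta'$; it is a weak $L$-tree. -}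

module Defs where

open import Data.Nat using (ℕ)
open import Data.Fin using (Fin)
open import Data.Product using (Σ; Σ-syntax; ∃; _×_; _,_)
open import Data.Sum using (_⊎_)
open import Relation.Binary.PropositionalEquality using (_≡_; _≢_)
open import Relation.Binary.Structures using (IsTotalOrder; IsPartialOrder)

record LinearOrder : Set₁ where
  field
    Carrier : Set
    _≤_     : Carrier → Carrier → Set
    isTotalOrder : IsTotalOrder _≡_ _≤_

  _<_ : Carrier → Carrier → Set
  x < y = x ≤ y × x ≢ y

Coinitial : (L : LinearOrder) {I : Set} → (I → LinearOrder.Carrier L) → Set
Coinitial L {I} s = ∀ ℓ → Σ[ i ∈ I ] (s i ≤ ℓ)
  where open LinearOrder L

-- coi(L) ≤ ℵ₀ : some κ-sequence with κ ≤ ℵ₀ (κ finite or κ = ω) is coinitial.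
CoiLeAleph0 : LinearOrder → Set
CoiLeAleph0 L =
  (Σ[ n ∈ ℕ ] Σ[ s ∈ (Fin n → Carrier) ] Coinitial L s)
  ⊎ (Σ[ s ∈ (ℕ → Carrier) ] Coinitial L s)
  where open LinearOrder L

record WeakTree (L : LinearOrder) : Set₁ where
  open LinearOrder L renaming (Carrier to Lc; _≤_ to _≤L_; _<_ to _<L_)
  field
    T     : Set
    _≤T_  : T → T → Set
    isPartialOrder : IsPartialOrder _≡_ _≤T_
    lev   : T → Lc
    lev-surj : ∀ ℓ → Σ[ t ∈ T ] (lev t ≡ ℓ)

  _<T_ : T → T → Set
  t <T t' = t ≤T t' × t ≢ t'

  field
    lev-mono : ∀ {t t'} → t <T t' → lev t <L lev t'
    restrict : ∀ t ℓ → lev t ≤L ℓ →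
      Σ[ u ∈ T ] ((t ≤T u × lev u ≡ ℓ) ×
                  (∀ u' → t ≤T u' → lev u' ≡ ℓ → u' ≡ u))
    meet-above : ∀ t t' → Σ[ ℓ ∈ Lc ] Σ[ u ∈ T ]
      (lev t ≤L ℓ × lev t' ≤L ℓ × t ≤T u × t' ≤T u × lev u ≡ ℓ)

module _ {L : LinearOrder} (𝒯 : WeakTree L) where
  open LinearOrder L renaming (Carrier to Lc; _≤_ to _≤L_)
  open WeakTree 𝒯

  record Automorphism : Set where
    field
      f      : T → T
      f⁻¹    : T → T
      inv₁   : ∀ t → f (f⁻¹ t) ≡ t
      inv₂   : ∀ t → f⁻¹ (f t) ≡ t
      f-mono   : ∀ {t t'} → t ≤T t' → f t ≤T f t'
      f⁻¹-mono : ∀ {t t'} → t ≤T t' → f⁻¹ t ≤T f⁻¹ t'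
      f-lev  : ∀ t → lev (f t) ≡ lev t

  _∼_ : T → T → Set
  t ∼ t' = Σ[ φ ∈ Automorphism ] (Automorphism.f φ t ≡ t')

  IsBranch : (Lc → T) → Set
  IsBranch b = (∀ ℓ → lev (b ℓ) ≡ ℓ) × (∀ {ℓ ℓ'} → ℓ ≤L ℓ' → b ℓ ≤T b ℓ')

  -- Condensed tree Δ(𝒯): elements are ∼-classes, represented by any
  -- representative t (standing for [t]); level λ([t]) = λ(t);
  -- [s] ≤ [s'] iff x ≤T x' for some x ∼ s, x' ∼ s'.
  _≤Δ_ : T → T → Set
  s ≤Δ s' = Σ[ x ∈ T ] Σ[ x' ∈ T ] (s ∼ x × s' ∼ x' × x ≤T x')

  -- Branch of Δ(𝒯), given by a choice of representatives b ℓ of the class at ℓ.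
  IsΔBranch : (Lc → T) → Set
  IsΔBranch b = (∀ ℓ → lev (b ℓ) ≡ ℓ) × (∀ {ℓ ℓ'} → ℓ ≤L ℓ' → b ℓ ≤Δ b ℓ')

{-# OPTIONS --safe #-}
-- Walk down the given Δ-branch from t: along a coinitial sequence s₀, s₁, … choose
-- u₀ = t ≥ u₁ ≥ u₂ ≥ … with uₖ₊₁ at level at most sₖ and in the class of b at its
-- level (an automorphism moving a witness of b(sₖ) ≤ b(lev uₖ) onto uₖ supplies uₖ₊₁).
-- The uₖ form a chain of the tree reaching below every level, so the branch through
-- all of them is b'(ℓ) = uₖ|ℓ for any k with lev uₖ ≤ ℓ; and uₖ|ℓ lies in b(ℓ) because
-- the same automorphism argument, upwards, puts an element of b(ℓ) above uₖ, which by
-- uniqueness of restrictions must be uₖ|ℓ.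
module Submission where

open import Defs
open import Data.Empty using (⊥-elim)
open import Data.Fin using (toℕ; fromℕ<)
open import Data.Fin.Properties using (fromℕ<-toℕ; toℕ<n)
open import Data.Nat using (ℕ; zero; suc; _<?_; _≤′_; ≤′-refl; ≤′-step)
open import Data.Nat.Properties using (≤-total; ≤⇒≤′)
open import Data.Product using (Σ; Σ-syntax; _×_; _,_; proj₁; proj₂)
open import Data.Sum using (inj₁; inj₂)
open import Relation.Nullary using (yes; no)
open import Relation.Binary.PropositionalEquality using (_≡_; refl; sym; trans; cong; subst)
open import Relation.Binary.Structures using (IsTotalOrder; IsPartialOrder)

module _ (L : LinearOrder) where
  open LinearOrder L

  coinitialSequence : CoiLeAleph0 L → Carrier →
                      Σ[ s ∈ (ℕ → Carrier) ] Coinitial L s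
  coinitialSequence (inj₂ s-coi) _ = s-coi
  coinitialSequence (inj₁ (n , s , s-coi)) ℓ₀ = padded , padded-coi
    where
    padded : ℕ → Carrier
    padded k with k <? n
    ... | yes k<n = s (fromℕ< k<n)
    ... | no _    = ℓ₀

    padded-toℕ : ∀ i → padded (toℕ i) ≡ s i
    padded-toℕ i with toℕ i <? n
    ... | yes i<n = cong s (fromℕ<-toℕ i i<n)
    ... | no i≮n  = ⊥-elim (i≮n (toℕ<n i))

    padded-coi : Coinitial L padded
    padded-coi ℓ =
      let (i , sᵢ≤ℓ) = s-coi ℓ in toℕ i , subst (_≤ ℓ) (sym (padded-toℕ i)) sᵢ≤ℓ

module Tree {L : LinearOrder} (𝒯 : WeakTree L) where
  open LinearOrder L renaming (Carrier to Lc; _≤_ to _≤L_)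
  open WeakTree 𝒯
  open Automorphism
  module ≤L = IsTotalOrder isTotalOrder
  module ≤T = IsPartialOrder isPartialOrder

  infix 4 _≅_
  _≅_ : T → T → Set
  _≅_ = _∼_ 𝒯

  inverse : Automorphism 𝒯 → Automorphism 𝒯
  inverse φ = record
    { f        = f⁻¹ φ
    ; f⁻¹      = f φ
    ; inv₁     = inv₂ φ
    ; inv₂     = inv₁ φ
    ; f-mono   = f⁻¹-mono φ
    ; f⁻¹-mono = f-mono φ
    ; f-lev    = λ x → trans (sym (f-lev φ (f⁻¹ φ x))) (cong lev (inv₁ φ x))
    }

  _∘ᴬ_ : Automorphism 𝒯 → Automorphism 𝒯 → Automorphism 𝒯
  φ ∘ᴬ ψ = record
    { f        = λ x → f φ (f ψ x)
    ; f⁻¹      = λ x → f⁻¹ ψ (f⁻¹ φ x)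
    ; inv₁     = λ x → trans (cong (f φ) (inv₁ ψ _)) (inv₁ φ x)
    ; inv₂     = λ x → trans (cong (f⁻¹ ψ) (inv₂ φ _)) (inv₂ ψ x)
    ; f-mono   = λ p → f-mono φ (f-mono ψ p)
    ; f⁻¹-mono = λ p → f⁻¹-mono ψ (f⁻¹-mono φ p)
    ; f-lev    = λ x → trans (f-lev φ _) (f-lev ψ x)
    }

  ≅-sym : ∀ {x y} → x ≅ y → y ≅ x
  ≅-sym (φ , refl) = inverse φ , inv₂ φ _

  ≅-trans : ∀ {x y z} → x ≅ y → y ≅ z → x ≅ z
  ≅-trans (φ , refl) (ψ , refl) = ψ ∘ᴬ φ , refl

  ≅-lev : ∀ {x y} → x ≅ y → lev x ≡ lev y
  ≅-lev (φ , refl) = sym (f-lev φ _)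

  ≅-lift-above : ∀ {x x' u} → x ≅ u → x ≤T x' → Σ[ v ∈ T ] (u ≤T v × x' ≅ v)
  ≅-lift-above (φ , refl) x≤x' = f φ _ , f-mono φ x≤x' , φ , refl

  ≅-lift-below : ∀ {x x' u} → x' ≅ u → x ≤T x' → Σ[ v ∈ T ] (v ≤T u × x ≅ v)
  ≅-lift-below (φ , refl) x≤x' = f φ _ , f-mono φ x≤x' , φ , refl

  raise : ∀ {ℓ} t → lev t ≤L ℓ → T
  raise t p = proj₁ (restrict t _ p)

  ≤-raise : ∀ {ℓ t} (p : lev t ≤L ℓ) → t ≤T raise t p
  ≤-raise p = proj₁ (proj₁ (proj₂ (restrict _ _ p)))

  lev-raise : ∀ {ℓ t} (p : lev t ≤L ℓ) → lev (raise t p) ≡ ℓ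
  lev-raise p = proj₂ (proj₁ (proj₂ (restrict _ _ p)))

  raise-unique : ∀ {ℓ t u} (p : lev t ≤L ℓ) → t ≤T u → lev u ≡ ℓ → u ≡ raise t p
  raise-unique p = proj₂ (proj₂ (restrict _ _ p)) _

  raise-id : ∀ {ℓ t} (p : lev t ≤L ℓ) → lev t ≡ ℓ → raise t p ≡ t
  raise-id p lev≡ℓ = sym (raise-unique p ≤T.refl lev≡ℓ)

  raise-≤T : ∀ {ℓ w a} → w ≤T a → (p : lev w ≤L ℓ) (q : lev a ≤L ℓ) →
             raise w p ≡ raise a q
  raise-≤T w≤a p q = sym (raise-unique p (≤T.trans w≤a (≤-raise q)) (lev-raise q))

  raise-mono : ∀ {ℓ ℓ' t} (p : lev t ≤L ℓ) (p' : lev t ≤L ℓ') → ℓ ≤L ℓ' →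
               raise t p ≤T raise t p'
  raise-mono p p' ℓ≤ℓ' =
    subst (raise _ p ≤T_) (sym (raise-≤T (≤-raise p) p' q)) (≤-raise q)
    where
    q : lev (raise _ p) ≤L _
    q = subst (_≤L _) (sym (lev-raise p)) ℓ≤ℓ'

  module DescendingChain
    (u : ℕ → T) (u-desc : ∀ k → u (suc k) ≤T u k)
    (u-coinitial : ∀ ℓ → Σ[ k ∈ ℕ ] lev (u k) ≤L ℓ)
    where

    chain-≤ : ∀ {i j} → i ≤′ j → u j ≤T u i
    chain-≤ ≤′-refl        = ≤T.refl
    chain-≤ (≤′-step i≤j) = ≤T.trans (u-desc _) (chain-≤ i≤j)

    raise-chain : ∀ {ℓ} i j (p : lev (u i) ≤L ℓ) (q : lev (u j) ≤L ℓ) →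
                  raise (u i) p ≡ raise (u j) q
    raise-chain i j p q with ≤-total i j
    ... | inj₁ i≤j = sym (raise-≤T (chain-≤ (≤⇒≤′ i≤j)) q p)
    ... | inj₂ j≤i = raise-≤T (chain-≤ (≤⇒≤′ j≤i)) p q

    branch : Lc → T
    branch ℓ = raise (u (proj₁ (u-coinitial ℓ))) (proj₂ (u-coinitial ℓ))

    branch-≡ : ∀ {ℓ} k (p : lev (u k) ≤L ℓ) → branch ℓ ≡ raise (u k) p
    branch-≡ k p = raise-chain _ k _ p

    branch-isBranch : IsBranch 𝒯 branch
    branch-isBranch = (λ ℓ → lev-raise _) , branch-mono
      where
      branch-mono : ∀ {ℓ ℓ'} → ℓ ≤L ℓ' → branch ℓ ≤T branch ℓ'
      branch-mono {ℓ} ℓ≤ℓ' =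
        let (k , p) = u-coinitial ℓ
            p' = ≤L.trans p ℓ≤ℓ'
        in subst (branch ℓ ≤T_) (sym (branch-≡ k p')) (raise-mono p p' ℓ≤ℓ')

    branch-through : ∀ {ℓ} k → lev (u k) ≡ ℓ → branch ℓ ≡ u k
    branch-through k lev≡ℓ =
      trans (branch-≡ k (≤L.reflexive lev≡ℓ)) (raise-id (≤L.reflexive lev≡ℓ) lev≡ℓ)

  module ΔBranch (b : Lc → T) (bΔ : IsΔBranch 𝒯 b) where

    ≅b-lev : ∀ {u ℓ} → u ≅ b ℓ → lev u ≡ ℓ
    ≅b-lev u≅bℓ = trans (≅-lev u≅bℓ) (proj₁ bΔ _)

    ≅b-above : ∀ {u m ℓ} → u ≅ b m → m ≤L ℓ → Σ[ v ∈ T ] (u ≤T v × v ≅ b ℓ)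
    ≅b-above u≅bm m≤ℓ =
      let (x , x' , bm≅x , bℓ≅x' , x≤x') = proj₂ bΔ m≤ℓ
          (v , u≤v , x'≅v) = ≅-lift-above (≅-sym (≅-trans u≅bm bm≅x)) x≤x'
      in v , u≤v , ≅-sym (≅-trans bℓ≅x' x'≅v)

    ≅b-below : ∀ {u m ℓ} → u ≅ b m → ℓ ≤L m → Σ[ v ∈ T ] (v ≤T u × v ≅ b ℓ)
    ≅b-below u≅bm ℓ≤m =
      let (x , x' , bℓ≅x , bm≅x' , x≤x') = proj₂ bΔ ℓ≤m
          (v , v≤u , x≅v) = ≅-lift-below (≅-sym (≅-trans u≅bm bm≅x')) x≤x'
      in v , v≤u , ≅-sym (≅-trans bℓ≅x x≅v)

    OnΔBranch : T → Set
    OnΔBranch u = u ≅ b (lev u)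

    ≅b⇒OnΔBranch : ∀ {u ℓ} → u ≅ b ℓ → OnΔBranch u
    ≅b⇒OnΔBranch {u} u≅bℓ = subst (λ m → u ≅ b m) (sym (≅b-lev u≅bℓ)) u≅bℓ

    OnΔBranch⇒≅b : ∀ {u ℓ} → OnΔBranch u → lev u ≡ ℓ → u ≅ b ℓ
    OnΔBranch⇒≅b u-on refl = u-on

    raise-OnΔBranch : ∀ {u ℓ} → OnΔBranch u → (p : lev u ≤L ℓ) → OnΔBranch (raise u p)
    raise-OnΔBranch u-on p =
      let (v , u≤v , v≅bℓ) = ≅b-above u-on p
      in ≅b⇒OnΔBranch (subst (_≅ b _) (raise-unique p u≤v (≅b-lev v≅bℓ)) v≅bℓ)

    descend : ∀ {u} → OnΔBranch u → ∀ σ →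
              Σ[ v ∈ T ] (v ≤T u × lev v ≤L σ × OnΔBranch v)
    descend {u} u-on σ with ≤L.total (lev u) σ
    ... | inj₁ lev≤σ = u , ≤T.refl , lev≤σ , u-on
    ... | inj₂ σ≤lev =
      let (v , v≤u , v≅bσ) = ≅b-below u-on σ≤lev
      in v , v≤u , ≤L.reflexive (≅b-lev v≅bσ) , ≅b⇒OnΔBranch v≅bσ

    module Descent (s : ℕ → Lc) (s-coi : Coinitial L s) {t} (t-on : OnΔBranch t) where

      descent : ℕ → Σ T OnΔBranch
      descent zero    = t , t-on
      descent (suc k) =
        let (v , _ , _ , v-on) = descend (proj₂ (descent k)) (s k) in v , v-on

      u : ℕ → T
      u k = proj₁ (descent k)

      u-desc : ∀ k → u (suc k) ≤T u k
      u-desc k = proj₁ (proj₂ (descend (proj₂ (descent k)) (s k)))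

      u-below : ∀ k → lev (u (suc k)) ≤L s k
      u-below k = proj₁ (proj₂ (proj₂ (descend (proj₂ (descent k)) (s k))))

      u-coinitial : ∀ ℓ → Σ[ k ∈ ℕ ] lev (u k) ≤L ℓ
      u-coinitial ℓ = let (i , sᵢ≤ℓ) = s-coi ℓ in suc i , ≤L.trans (u-below i) sᵢ≤ℓ

      open DescendingChain u u-desc u-coinitial public

      branch-≅b : ∀ ℓ → branch ℓ ≅ b ℓ
      branch-≅b ℓ =
        let (k , p) = u-coinitial ℓ
        in OnΔBranch⇒≅b (raise-OnΔBranch (proj₂ (descent k)) p) (lev-raise p)

lemma3p3 : (L : LinearOrder) → CoiLeAleph0 L →
    (𝒯 : WeakTree L) →
    (b : LinearOrder.Carrier L → WeakTree.T 𝒯) → IsΔBranch 𝒯 b →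
    (ℓ̄ : LinearOrder.Carrier L) → (t : WeakTree.T 𝒯) → _∼_ 𝒯 t (b ℓ̄) →
    Σ[ b' ∈ (LinearOrder.Carrier L → WeakTree.T 𝒯) ]
      (IsBranch 𝒯 b' × b' ℓ̄ ≡ t × (∀ ℓ → _∼_ 𝒯 (b' ℓ) (b ℓ)))
lemma3p3 L coi 𝒯 b bΔ ℓ̄ t t≅bℓ̄ =
  branch , branch-isBranch , branch-through 0 (≅b-lev t≅bℓ̄) , branch-≅b
  where
  open Tree 𝒯
  open ΔBranch b bΔ

  s-coi : Σ[ s ∈ (ℕ → LinearOrder.Carrier L) ] Coinitial L s
  s-coi = coinitialSequence L coi ℓ̄

  open Descent (proj₁ s-coi) (proj₂ s-coi) (≅b⇒OnΔBranch t≅bℓ̄)
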